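{- Let $G$ be a finite simple graph. Suppose either (1) there are exactly two bad degrees, there is a dull vertex $v$ whose degree is not shared by any other vertex, and a bad vertex $u$ whose degree is not shared by any other vertex, with $d_u \ne d_v + 1$; or (2) there are exactly three bad degrees, and there are two vertices $u, v$, each of which is both bad and dull and has a degree not shared by any other vertex. Then $G - v$ is ds-completable or $G - u$ is ds-completable.
   Context: $d_x$ denotes the degree of vertex $x$. A degree $d$ is bad if $G$ contains a vertex of degree $d-1$, and dull if $G$ contains a vertex of degree $d+1$; a vertex is bad or dull according as its degree is. For a vertex $v$, the card $G-v$ is ds-completable if, for each integer $d$, the vertices having degree $d$ in $G-v$ are either all neighbours of $v$ in $G$ or all non-neighbours of $v$ in $G$. -}

module Defs where

open import Data.Nat using (ℕ; suc)
open import Data.Bool using (Bool; true; false; _∧_; not)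
open import Data.Fin using (Fin)
open import Data.Fin.Properties using (_≟_)
open import Data.List using (List; length; filterᵇ)
open import Data.List.Membership.Propositional using (_∈_)
open import Data.List.Relation.Unary.Unique.Propositional using (Unique)
open import Data.List.Base using ()
open import Data.Vec.Functional using ()
open import Data.Fin.Base using ()
open import Data.Product using (_×_; ∃)
open import Data.Sum using (_⊎_)
open import Function.Bundles using (_⇔_)
open import Relation.Nullary using (¬_; does)
open import Relation.Binary.PropositionalEquality using (_≡_)
import Data.List as L

allV : (n : ℕ) → List (Fin n)
allV n = L.allFin n

record Graph (n : ℕ) : Set where
  field
    adj    : Fin n → Fin n → Bool
    sym    : ∀ x y → adj x y ≡ adj y x
    irrefl : ∀ x → adj x x ≡ false
open Graph public

module _ {n : ℕ} (G : Graph n) where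

  deg : Fin n → ℕ
  deg x = length (filterᵇ (adj G x) (allV n))

  -- degree of x in the card G - v (x ≠ v): neighbours of x other than v
  degDel : Fin n → Fin n → ℕ
  degDel v x = length (filterᵇ (λ y → adj G x y ∧ not (does (y ≟ v))) (allV n))

  BadDeg : ℕ → Set
  BadDeg d = ∃ λ w → suc (deg w) ≡ d

  DullDeg : ℕ → Set
  DullDeg d = ∃ λ w → deg w ≡ suc d

  BadV : Fin n → Set
  BadV x = BadDeg (deg x)

  DullV : Fin n → Set
  DullV x = DullDeg (deg x)

  UniqueDeg : Fin n → Set
  UniqueDeg x = ∀ w → deg w ≡ deg x → w ≡ x

  BadDegreeOfG : ℕ → Set
  BadDegreeOfG d = (∃ λ x → deg x ≡ d) × BadDeg d

  ExactlyBadDegrees : ℕ → Set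
  ExactlyBadDegrees k =
    ∃ λ (ds : List ℕ) → Unique ds × length ds ≡ k × (∀ d → (d ∈ ds) ⇔ BadDegreeOfG d)

  DsCompletable : Fin n → Set
  DsCompletable v =
    ∀ d → (∀ x → ¬ x ≡ v → degDel v x ≡ d → adj G v x ≡ true)
        ⊎ (∀ x → ¬ x ≡ v → degDel v x ≡ d → adj G v x ≡ false)

  Case1 : Fin n → Fin n → Set
  Case1 u v = ExactlyBadDegrees 2 × DullV v × UniqueDeg v × BadV u × UniqueDeg u
            × ¬ deg u ≡ suc (deg v)

  Case2 : Fin n → Fin n → Set
  Case2 u v = ExactlyBadDegrees 3 × ¬ u ≡ v
            × BadV u × DullV u × UniqueDeg u
            × BadV v × DullV v × UniqueDeg v

module Submission where

-- Deleting v lowers by one exactly the degrees of the neighbours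
-- of v, so two vertices of G - v share a degree while lying on different sides
-- of v precisely when v has a neighbour x and a non-neighbour y ≠ v with
-- d_x = d_y + 1.  Hence G - v is ds-completable as soon as no such "cross
-- pair" exists (noCrossPair⇒completable).  Every pair x, y with d_x = d_y + 1
-- makes d_x a bad degree of G; since G has only k bad degrees, a pigeonhole
-- argument on duplicate-free lists shows that, once k bad degrees are known,
-- they are all of them (bad-degrees-listed).  In both cases of the theorem
-- this pins every such pair to u and v (x = u, or y = v, or (x, y) = (v, u)),
-- and such "anchored" pairs can never be cross pairs for v when u ≁ v, nor
-- for u when u ∼ v (completable-from-anchored-steps).  In case (2) a
-- pigeonhole step first shows that d_u and d_v differ by exactly one.

open import Defs hiding (sym)
open import Data.Nat using (ℕ; suc; z≤n; _≤_)
open import Data.Nat.Properties using (suc-injective; m≢1+n+m; module ≤-Reasoning)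
import Data.Nat.Properties as ℕ
open import Data.Fin using (Fin)
open import Data.Fin.Properties using (_≟_; any?)
open import Data.Bool using (Bool; true; false; _∧_; not)
open import Data.Bool.Properties using () renaming (_≟_ to _≟ᵇ_)
open import Data.Empty using (⊥; ⊥-elim)
open import Data.List using (List; []; _∷_; length; filterᵇ; filter)
open import Data.List.Properties using (filter-notAll)
open import Data.List.Relation.Unary.Any as Any using (here; there)
open import Data.List.Relation.Unary.All as All using (All; []; _∷_)
open import Data.List.Relation.Unary.All.Properties using (¬Any⇒All¬; All¬⇒¬Any)
open import Data.List.Relation.Unary.AllPairs using ([]; _∷_)
open import Data.List.Relation.Unary.Unique.Propositional using (Unique)
open import Data.List.Relation.Unary.Unique.Propositional.Properties using (allFin⁺)
open import Data.List.Relation.Binary.Subset.Propositional using (_⊆_)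
open import Data.List.Membership.Propositional using (_∈_)
open import Data.List.Membership.Propositional.Properties using (∈-allFin; ∈-filter⁺)
open import Data.List.Membership.DecPropositional ℕ._≟_ using (_∈?_)
open import Data.Product using (_×_; _,_)
open import Data.Sum using (_⊎_; inj₁; inj₂; swap)
open import Function using (_∘_)
open import Function.Bundles using (Equivalence)
open import Relation.Nullary using (¬_; Dec; does; yes; no; ¬?)
open import Relation.Nullary.Decidable using (_×-dec_)
open import Relation.Binary.Definitions using (DecidableEquality)
open import Relation.Binary.PropositionalEquality using (_≡_; refl; sym; trans; cong; module ≡-Reasoning)

-- Removing the head y from xs (by filtering out y) makes xs
-- strictly shorter while keeping the remaining elements of ys.
unique⊆⇒length≤ : {A : Set} (eq? : DecidableEquality A) {ys xs : List A}
                → Unique ys → ys ⊆ xs → length ys ≤ length xs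
unique⊆⇒length≤ eq? {[]} _ _ = z≤n
unique⊆⇒length≤ {A} eq? {y ∷ ys} {xs} (y∉ys ∷ uniq) ys⊆xs = begin-strict
  length ys                    ≤⟨ unique⊆⇒length≤ eq? uniq ys⊆xs∖y ⟩
  length (filter (y ≢?_) xs)   <⟨ filter-notAll (y ≢?_) xs (Any.map (λ y≡z y≢z → y≢z y≡z) (ys⊆xs (here refl))) ⟩
  length xs                    ∎
  where
  open ≤-Reasoning
  _≢?_ : (a b : A) → Dec (¬ a ≡ b)
  a ≢? b = ¬? (eq? a b)
  ys⊆xs∖y : ys ⊆ filter (y ≢?_) xs
  ys⊆xs∖y z∈ys = ∈-filter⁺ (y ≢?_) (ys⊆xs (there z∈ys)) (All.lookup y∉ys z∈ys)

module Deletion {n : ℕ} (f : Fin n → Bool) (v : Fin n) where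

  f∖v : Fin n → Bool
  f∖v y = f y ∧ not (does (y ≟ v))

  count-unaffected : ∀ xs → (v ∈ xs → f v ≡ false)
                   → length (filterᵇ f xs) ≡ length (filterᵇ f∖v xs)
  count-unaffected []       _   = refl
  count-unaffected (y ∷ xs) fv with y ≟ v
  ... | yes refl rewrite fv (here refl) = count-unaffected xs (fv ∘ there)
  ... | no _ with f y
  ...   | true  = cong suc (count-unaffected xs (fv ∘ there))
  ...   | false = count-unaffected xs (fv ∘ there)

  count-drops-one : f v ≡ true → ∀ xs → Unique xs → v ∈ xs
                  → length (filterᵇ f xs) ≡ suc (length (filterᵇ f∖v xs))
  count-drops-one fv (y ∷ xs) (v∉xs ∷ _) (here refl) with y ≟ y
  ... | no y≢y = ⊥-elim (y≢y refl)
  ... | yes _ rewrite fv = cong suc (count-unaffected xs (⊥-elim ∘ All¬⇒¬Any v∉xs))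
  count-drops-one fv (y ∷ xs) (y∉xs ∷ uniq) (there v∈xs) with y ≟ v
  ... | yes refl = ⊥-elim (All¬⇒¬Any y∉xs v∈xs)
  ... | no _ with f y
  ...   | true  = cong suc (count-drops-one fv xs uniq v∈xs)
  ...   | false = count-drops-one fv xs uniq v∈xs

module _ {n : ℕ} (G : Graph n) where

  deg-neighbour : ∀ v x → adj G x v ≡ true → deg G x ≡ suc (degDel G v x)
  deg-neighbour v x x∼v = count-drops-one x∼v (allV n) (allFin⁺ n) (∈-allFin v)
    where open Deletion (adj G x) v

  deg-nonNeighbour : ∀ v x → adj G x v ≡ false → deg G x ≡ degDel G v x
  deg-nonNeighbour v x x≁v = count-unaffected (allV n) (λ _ → x≁v)
    where open Deletion (adj G x) v

  -- A cross pair for v: a neighbour x and a non-neighbour y ≠ v of v which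
  -- get the same degree in G - v, i.e. with d_x = d_y + 1.
  NoCrossPair : Fin n → Set
  NoCrossPair v = ∀ x y → adj G v x ≡ true → ¬ y ≡ v → adj G v y ≡ false
                → deg G x ≡ suc (deg G y) → ⊥

  noCrossPair⇒completable : ∀ v → NoCrossPair v → DsCompletable G v
  noCrossPair⇒completable v noCross d
    with any? (λ x → (adj G v x ≟ᵇ true) ×-dec (degDel G v x ℕ.≟ d))
  ... | yes (x , v∼x , x↦d) = inj₁ allNeighbours
    where
    allNeighbours : ∀ y → ¬ y ≡ v → degDel G v y ≡ d → adj G v y ≡ true
    allNeighbours y y≢v y↦d with adj G v y in v≁y
    ... | true  = refl
    ... | false = ⊥-elim (noCross x y v∼x y≢v v≁y (begin
      deg G x               ≡⟨ deg-neighbour v x (trans (Graph.sym G x v) v∼x) ⟩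
      suc (degDel G v x)    ≡⟨ cong suc (trans x↦d (sym y↦d)) ⟩
      suc (degDel G v y)    ≡⟨ cong suc (sym (deg-nonNeighbour v y (trans (Graph.sym G y v) v≁y))) ⟩
      suc (deg G y)         ∎))
      where open ≡-Reasoning
  ... | no noNeighbour = inj₂ allNonNeighbours
    where
    allNonNeighbours : ∀ y → ¬ y ≡ v → degDel G v y ≡ d → adj G v y ≡ false
    allNonNeighbours y _ y↦d with adj G v y in v∼y
    ... | false = refl
    ... | true  = ⊥-elim (noNeighbour (y , v∼y , y↦d))

  private
    conflict : ∀ {b : Bool} → b ≡ true → b ≡ false → ⊥
    conflict refl ()

  Anchored : Fin n → Fin n → Set
  Anchored u v = ∀ x y → deg G x ≡ suc (deg G y) → x ≡ u ⊎ y ≡ v ⊎ (x ≡ v × y ≡ u)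

  -- If all such pairs are anchored, no cross pair exists for v when u ≁ v
  -- (x = u would be a neighbour of v, x = v is not), and none exists for u
  -- when u ∼ v (x = u is no neighbour of u, y = v is not a non-neighbour).
  completable-from-anchored-steps : ∀ u v → Anchored u v → DsCompletable G v ⊎ DsCompletable G u
  completable-from-anchored-steps u v anchored with adj G u v in adj-uv
  ... | false = inj₁ (noCrossPair⇒completable v noCross)
    where
    noCross : NoCrossPair v
    noCross x y v∼x y≢v _ step with anchored x y step
    ... | inj₁ refl              = conflict v∼x (trans (Graph.sym G v u) adj-uv)
    ... | inj₂ (inj₁ refl)       = y≢v refl
    ... | inj₂ (inj₂ (refl , _)) = conflict v∼x (irrefl G v)
  ... | true = inj₂ (noCrossPair⇒completable u noCross)
    where
    noCross : NoCrossPair u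
    noCross x y u∼x y≢u u≁y step with anchored x y step
    ... | inj₁ refl              = conflict u∼x (irrefl G u)
    ... | inj₂ (inj₁ refl)       = conflict adj-uv u≁y
    ... | inj₂ (inj₂ (_ , refl)) = y≢u refl

  step⇒bad : ∀ x y → deg G x ≡ suc (deg G y) → BadDegreeOfG G (deg G x)
  step⇒bad x y step = (x , refl) , (y , sym step)

  bad-degrees-bounded : ∀ {k} → ExactlyBadDegrees G k
                      → ∀ {as} → Unique as → All (BadDegreeOfG G) as → length as ≤ k
  bad-degrees-bounded (ds , _ , refl , listed) uniq bad =
    unique⊆⇒length≤ ℕ._≟_ uniq (λ d∈as → Equivalence.from (listed _) (All.lookup bad d∈as))

  bad-degrees-listed : ∀ {k} → ExactlyBadDegrees G k
                     → ∀ {as} → Unique as → length as ≡ k → All (BadDegreeOfG G) as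
                     → ∀ {d} → BadDegreeOfG G d → d ∈ as
  bad-degrees-listed exact {as} uniq refl bad {d} d-bad with d ∈? as
  ... | yes d∈as = d∈as
  ... | no  d∉as = ⊥-elim (ℕ.1+n≰n (bad-degrees-bounded exact (¬Any⇒All¬ as d∉as ∷ uniq) (d-bad ∷ bad)))

  -- Case (1): the bad degrees are d_u and d_v + 1, so a pair with d_x = d_y + 1
  -- has x = u or d_y = d_v, i.e. y = v.
  case1 : ∀ u v → Case1 G u v → DsCompletable G v ⊎ DsCompletable G u
  case1 u v (exact , (w , w-dull) , v-unique , u-bad , u-unique , du≢dv+1) =
    completable-from-anchored-steps u v anchored
    where
    classify : ∀ {d} → BadDegreeOfG G d → d ∈ (deg G u ∷ suc (deg G v) ∷ [])
    classify = bad-degrees-listed exact ((du≢dv+1 ∷ []) ∷ [] ∷ []) refl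
                 (((u , refl) , u-bad) ∷ ((w , w-dull) , (v , refl)) ∷ [])
    anchored : Anchored u v
    anchored x y step with classify (step⇒bad x y step)
    ... | here dx≡du              = inj₁ (u-unique x dx≡du)
    ... | there (here dx≡dv+1)    = inj₂ (inj₁ (v-unique y (suc-injective (trans (sym step) dx≡dv+1))))
    ... | there (there ())

  -- Case (2) with d_v = d_u + 1: the bad degrees are d_u, d_v and d_v + 1, so a
  -- pair with d_x = d_y + 1 has x = u, or (x, y) = (v, u), or y = v.
  case2-oriented : ∀ {u v} → ExactlyBadDegrees G 3
                 → BadV G u → UniqueDeg G u → DullV G v → UniqueDeg G v
                 → deg G v ≡ suc (deg G u) → DsCompletable G v ⊎ DsCompletable G u
  case2-oriented {u} {v} exact u-bad u-unique (w , w-dull) v-unique dv≡du+1 =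
    completable-from-anchored-steps u v anchored
    where
    du≢dv : ¬ deg G u ≡ deg G v
    du≢dv e = m≢1+n+m (deg G u) {0} (trans e dv≡du+1)
    du≢dv+1 : ¬ deg G u ≡ suc (deg G v)
    du≢dv+1 e = m≢1+n+m (deg G u) {1} (trans e (cong suc dv≡du+1))
    classify : ∀ {d} → BadDegreeOfG G d → d ∈ (deg G u ∷ deg G v ∷ suc (deg G v) ∷ [])
    classify = bad-degrees-listed exact
                 ((du≢dv ∷ du≢dv+1 ∷ []) ∷ (m≢1+n+m (deg G v) {0} ∷ []) ∷ [] ∷ []) refl
                 (((u , refl) , u-bad) ∷ ((v , refl) , (u , sym dv≡du+1))
                   ∷ ((w , w-dull) , (v , refl)) ∷ [])
    anchored : Anchored u v
    anchored x y step with classify (step⇒bad x y step)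
    ... | here dx≡du                  = inj₁ (u-unique x dx≡du)
    ... | there (here dx≡dv)          =
          inj₂ (inj₂ (v-unique x dx≡dv , u-unique y (suc-injective (trans (sym step) (trans dx≡dv dv≡du+1)))))
    ... | there (there (here dx≡dv+1)) = inj₂ (inj₁ (v-unique y (suc-injective (trans (sym step) dx≡dv+1))))
    ... | there (there (there ()))

  -- In case (2) the degrees of u and v are adjacent: otherwise d_u, d_v,
  -- d_u + 1, d_v + 1 would be four distinct bad degrees.
  adjacent-degrees : ∀ {u v} → ExactlyBadDegrees G 3 → ¬ deg G u ≡ deg G v
                   → BadV G u → DullV G u → BadV G v → DullV G v
                   → deg G v ≡ suc (deg G u) ⊎ deg G u ≡ suc (deg G v)
  adjacent-degrees {u} {v} exact du≢dv u-bad (wu , wu-dull) v-bad (wv , wv-dull)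
    with deg G v ℕ.≟ suc (deg G u) | deg G u ℕ.≟ suc (deg G v)
  ... | yes dv≡du+1 | _           = inj₁ dv≡du+1
  ... | no _        | yes du≡dv+1 = inj₂ du≡dv+1
  ... | no dv≢du+1  | no du≢dv+1  = ⊥-elim (ℕ.1+n≰n (bad-degrees-bounded exact distinct bad))
    where
    distinct : Unique (deg G u ∷ deg G v ∷ suc (deg G u) ∷ suc (deg G v) ∷ [])
    distinct = (du≢dv ∷ m≢1+n+m (deg G u) {0} ∷ du≢dv+1 ∷ [])
             ∷ (dv≢du+1 ∷ m≢1+n+m (deg G v) {0} ∷ [])
             ∷ ((du≢dv ∘ suc-injective) ∷ [])
             ∷ [] ∷ []
    bad : All (BadDegreeOfG G) (deg G u ∷ deg G v ∷ suc (deg G u) ∷ suc (deg G v) ∷ [])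
    bad = ((u , refl) , u-bad) ∷ ((v , refl) , v-bad)
        ∷ ((wu , wu-dull) , (u , refl)) ∷ ((wv , wv-dull) , (v , refl)) ∷ []

  case2 : ∀ u v → Case2 G u v → DsCompletable G v ⊎ DsCompletable G u
  case2 u v (exact , u≢v , u-bad , u-dull , u-unique , v-bad , v-dull , v-unique)
    with adjacent-degrees exact (u≢v ∘ v-unique u) u-bad u-dull v-bad v-dull
  ... | inj₁ dv≡du+1 = case2-oriented exact u-bad u-unique v-dull v-unique dv≡du+1
  ... | inj₂ du≡dv+1 = swap (case2-oriented exact v-bad v-unique u-dull u-unique du≡dv+1)

lemma5 : (n : ℕ) (G : Graph n) (u v : Fin n)
       → Case1 G u v ⊎ Case2 G u v
       → DsCompletable G v ⊎ DsCompletable G u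
lemma5 n G u v (inj₁ case-1) = case1 G u v case-1
lemma5 n G u v (inj₂ case-2) = case2 G u v case-2
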